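{- Let $\Omega=\{x_1,\dots,x_5\}$ with $\mathbb{P}(\{x_j\})=0.2$ for each $j$, and define $B_1=\{x_1,x_2,x_4\}$, $B_2=\{x_1,x_3,x_5\}$, $B_3=\{x_1,x_3,x_5\}$, $B_4=\{x_2,x_4,x_5\}$, $B_5=\{x_2,x_4,x_5\}$, $B_6=\{x_1,x_2,x_3\}$. Then \[ \mathrm{GK}(\{B_i\}_{i=1}^6)=\frac{54}{55}<1=\mathrm{KAT}(\{B_i\}_{i=1}^6). \] Consequently, for the periodic sequence $A_n=B_{((n-1)\bmod 6)+1}$, $n\ge1$, one has $\sum_n\mathbb{P}(A_n)=\infty$, \[ \mathbb{P}(A_\infty)\ \ge\ \mathrm{KAT}(\{B_i\}_{i=1}^6)=1, \] while for every strictly increasing $\tau:\mathbb{N}\to\mathbb{N}$, \[ \mathrm{ER}(\{A_{\tau(n)}\})\le \mathrm{GK}(\{B_i\}_{i=1}^6)=\frac{54}{55}. \] Thus the lower bound $\mathbb{P}(A_\infty)\ge \mathrm{KAT}(\{B_i\}_{i=1}^6)$, which depends only on the pairwise intersection probabilities, is not dominated by $\sup_\tau \mathrm{ER}(\{A_{\tau(n)}\})$ (supremum over increasing $\tau$).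
   Context: $A_\infty=\bigcap_{n=1}^\infty\bigcup_{k=n}^\infty A_k$. For a sequence of events $\{C_n\}$ with $\sum_n\mathbb{P}(C_n)=\infty$, the Erdős–Rényi quantity is $\mathrm{ER}(\{C_n\})=\limsup_{n\to\infty}\big(\sum_{k=1}^n\mathbb{P}(C_k)\big)^2\big/\sum_{i=1}^n\sum_{j=1}^n\mathbb{P}(C_iC_j)$, where $C_iC_j=C_i\cap C_j$. For finitely many events $B_1,\dots,B_m$ of positive probability, the Gallot–Kounias quantity is $\mathrm{GK}(\{B_i\}_{i=1}^m)=\max_{(\omega_1,\dots,\omega_m)\in\mathbb{R}^m}\big(\sum_i\omega_i\mathbb{P}(B_i)\big)^2\big/\sum_{i,j}\omega_i\omega_j\mathbb{P}(B_iB_j)$ (with $0/0:=0$), which equals $\sum_i\gamma_i$ for any solution $\gamma$ of $\sum_j\frac{\mathbb{P}(B_iB_j)}{\mathbb{P}(B_i)\mathbb{P}(B_j)}\gamma_j=1$, $i=1,\dots,m$. The Kuai–Alajaji–Takahara quantity is $\mathrm{KAT}(\{B_i\}_{i=1}^m)=\sum_{i=1}^m\Big(\frac{\theta_i\mathbb{P}(B_i)^2}{S_i+(1-\theta_i)\mathbb{P}(B_i)}+\frac{(1-\theta_i)\mathbb{P}(B_i)^2}{S_i-\theta_i\mathbb{P}(B_i)}\Big)$, where $S_i=\sum_{j=1}^m\mathbb{P}(B_iB_j)$ and $\theta_i$ is the fractional part of $S_i/\mathbb{P}(B_i)$. Both GK and KAT are known lower bounds for $\mathbb{P}(\bigcup_{i=1}^m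 B_i)$.
   Formalization: The weight vectors in the Gallot–Kounias maximum range over ℚ^6 rather than ℝ^6. -}

module Defs where

open import Data.Nat as ℕ using (ℕ; zero; suc; _%_)
open import Data.Integer using (+_)
open import Data.Nat.DivMod using (m%n<n)
open import Data.Fin as Fin using (Fin; fromℕ<)
open import Data.Fin.Subset using (Subset; _∩_; inside; outside)
open import Data.Vec using (Vec; []; _∷_; lookup)
open import Data.Bool using (if_then_else_)
open import Data.Rational as ℚ
  using (ℚ; 0ℚ; 1ℚ; _+_; _*_; _-_; _÷_; _≤_; _/_; floor; ≢-nonZero; _≟_)
open import Data.Product using (Σ; _×_; ∃)
open import Relation.Nullary using (yes; no)
open import Relation.Binary.PropositionalEquality using (_≡_)

sumFin : ∀ n → (Fin n → ℚ) → ℚ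
sumFin zero    f = 0ℚ
sumFin (suc n) f = f Fin.zero + sumFin n (λ i → f (Fin.suc i))

sumℕ : ℕ → (ℕ → ℚ) → ℚ
sumℕ zero    f = 0ℚ
sumℕ (suc n) f = sumℕ n f + f n

-- Quotient with the convention a / 0 := 0
frac : ℚ → ℚ → ℚ
frac a b with b ≟ 0ℚ
... | yes _  = 0ℚ
... | no b≢0 = _÷_ a b {{≢-nonZero b≢0}}

sq : ℚ → ℚ
sq x = x * x

-- Probability space Ω = {x₁,…,x₅} (x_{j+1} ↔ j : Fin 5), uniform with mass 1/5
Ω : Set
Ω = Fin 5

Event : Set
Event = Subset 5

ℙ : Event → ℚ
ℙ S = sumFin 5 (λ x → if lookup S x then (+ 1 / 5) else 0ℚ)

-- B₁,…,B₆ (B_{i+1} ↔ i : Fin 6); vectors list membership of x₁,…,x₅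
B : Fin 6 → Event
B Fin.zero = inside ∷ inside ∷ outside ∷ inside ∷ outside ∷ []
B (Fin.suc Fin.zero) = inside ∷ outside ∷ inside ∷ outside ∷ inside ∷ []
B (Fin.suc (Fin.suc Fin.zero)) = inside ∷ outside ∷ inside ∷ outside ∷ inside ∷ []
B (Fin.suc (Fin.suc (Fin.suc Fin.zero))) = outside ∷ inside ∷ outside ∷ inside ∷ inside ∷ []
B (Fin.suc (Fin.suc (Fin.suc (Fin.suc Fin.zero)))) = outside ∷ inside ∷ outside ∷ inside ∷ inside ∷ []
B (Fin.suc (Fin.suc (Fin.suc (Fin.suc (Fin.suc Fin.zero))))) = inside ∷ inside ∷ inside ∷ outside ∷ outside ∷ []

GKratio : (Fin 6 → ℚ) → ℚ
GKratio ω = frac (sq (sumFin 6 (λ i → ω i * ℙ (B i))))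
                 (sumFin 6 (λ i → sumFin 6 (λ j → ω i * ω j * ℙ (B i ∩ B j))))

IsGK : ℚ → Set
IsGK c = (∀ ω → GKratio ω ≤ c) × ∃ (λ ω → GKratio ω ≡ c)

fracPartℚ : ℚ → ℚ
fracPartℚ x = x - (floor x / 1)

KATterm : Fin 6 → ℚ
KATterm i =
  frac (θ * sq p) (S + (1ℚ - θ) * p) + frac ((1ℚ - θ) * sq p) (S - θ * p)
  where
  p = ℙ (B i)
  S = sumFin 6 (λ j → ℙ (B i ∩ B j))
  θ = fracPartℚ (frac S p)

KAT : ℚ
KAT = sumFin 6 KATterm

-- Periodic sequence, 0-indexed: A m = A_{m+1} = B_{(m mod 6)+1}
A : ℕ → Event
A m = B (fromℕ< (m%n<n m 6))

_∈A∞ : Ω → Set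
x ∈A∞ = ∀ n → ∃ λ k → n ℕ.≤ k × lookup (A k) x ≡ inside

SumDiverges : (ℕ → ℚ) → Set
SumDiverges a = ∀ (M : ℚ) → ∃ λ n → M ℚ.< sumℕ n a

LimsupLE : (ℕ → ℚ) → ℚ → Set
LimsupLE r c = ∀ (ε : ℚ) → 0ℚ ℚ.< ε → ∃ λ N → ∀ n → N ℕ.≤ n → r n ≤ c + ε

-- Erdős–Rényi ratio of the first n events of a sequence C (C 0 = C₁, …)
ERratio : (ℕ → Event) → ℕ → ℚ
ERratio C n = frac (sq (sumℕ n (λ k → ℙ (C k))))
                   (sumℕ n (λ i → sumℕ n (λ j → ℙ (C i ∩ C j))))

ERLE : (ℕ → Event) → ℚ → Set
ERLE C c = LimsupLE (ERratio C) c

StrictlyIncreasing : (ℕ → ℕ) → Set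
StrictlyIncreasing τ = ∀ m n → m ℕ.< n → τ m ℕ.< τ n

{-# OPTIONS --safe #-}
-- Every Bᵢ has three points, exactly one of them in {x₃, x₄}; so, writing 1_S for the
-- indicator vector of an event, all 1_{Bᵢ} lie in the hyperplane y · normal = 0 of ℚ⁵,
-- normal = (1, 1, −2, −2, 1).  For weights w on any finite family of such events put
-- y = Σᵢ wᵢ 1_{Eᵢ}: the Gallot–Kounias / Erdős–Rényi numerator is (Σₓ yₓ / 5)² and the
-- denominator is |y|² / 5.  By Cauchy–Schwarz against the projection p of (1, …, 1)
-- onto the hyperplane, the ratio is at most |p|² / 5 = 54/55, with equality for w = 1.
-- Every Erdős–Rényi ratio of a subsequence of the periodic sequence is such a ratio,
-- whereas the Bᵢ cover Ω and recur forever, so A∞ = Ω and KAT = 1 = ℙ(A∞).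
module Submission where

open import Defs
open import Algebra.Bundles using (CommutativeMonoid)
open import Data.Bool using (true; false; if_then_else_; _∧_)
open import Data.Fin as Fin using (Fin; toℕ; fromℕ<)
open import Data.Fin.Properties using (toℕ<n; fromℕ<-cong; fromℕ<-toℕ)
open import Data.Fin.Subset using (Subset; _∩_; _∈_; ⊤; inside)
open import Data.Fin.Subset.Properties using (∈⊤)
open import Data.Integer using (+_; -[1+_])
import Data.Integer as ℤ
import Data.Integer.Properties as ℤₚ
open import Data.Nat using (ℕ; zero; suc)
import Data.Nat as ℕ
import Data.Nat.Coprimality as Coprime
open import Data.Nat.DivMod using (m%n<n; [m+kn]%n≡m%n; m<n⇒m%n≡m)
import Data.Nat.Properties as ℕₚ
open import Data.Product using (_×_; ∃; _,_)
open import Data.Rational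
  using ( ℚ; 0ℚ; 1ℚ; _+_; _*_; _-_; -_; _/_; _÷_; 1/_; _≤_; _<_; mkℚ; ↥_; *<*
        ; NonZero; positive; nonNegative; nonPositive; ≢-nonZero )
import Data.Rational.Properties as ℚ
open import Data.Rational.Solver using (module +-*-Solver)
open import Data.Sum using (inj₁; inj₂)
open import Data.Unit using (tt)
open import Data.Vec using (lookup)
open import Data.Vec.Properties using (lookup-zipWith)
open import Function using (_∘_)
open import Function.Bundles using (_⇔_; mk⇔)
open import Relation.Binary.PropositionalEquality
open import Relation.Nullary using (yes; no)
open import Relation.Nullary.Decidable using (toWitness)
open import Algebra.Properties.CommutativeSemigroup
  (CommutativeMonoid.commutativeSemigroup ℚ.+-0-commutativeMonoid) using (interchange)

open +-*-Solver

record IsLinearFunctional {I : Set} (Σ : (I → ℚ) → ℚ) : Set where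
  field
    cong-pointwise : ∀ {f g} → (∀ i → f i ≡ g i) → Σ f ≡ Σ g
    additive       : ∀ f g → Σ (λ i → f i + g i) ≡ Σ f + Σ g
    homogeneous    : ∀ c f → Σ (λ i → c * f i) ≡ c * Σ f

  sum-zero : Σ (λ _ → 0ℚ) ≡ 0ℚ
  sum-zero = begin
    Σ (λ _ → 0ℚ)        ≡⟨ cong-pointwise (λ _ → refl) ⟩
    Σ (λ _ → 0ℚ * 0ℚ)   ≡⟨ homogeneous 0ℚ (λ _ → 0ℚ) ⟩
    0ℚ * Σ (λ _ → 0ℚ)   ≡⟨ ℚ.*-zeroˡ (Σ (λ _ → 0ℚ)) ⟩
    0ℚ                  ∎
    where open ≡-Reasoning

  swap-sumFin : ∀ m (f : I → Fin m → ℚ) →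
                Σ (λ i → sumFin m (f i)) ≡ sumFin m (λ x → Σ (λ i → f i x))
  swap-sumFin zero    f = sum-zero
  swap-sumFin (suc m) f = begin
    Σ (λ i → f i Fin.zero + sumFin m (λ x → f i (Fin.suc x)))
      ≡⟨ additive _ _ ⟩
    Σ (λ i → f i Fin.zero) + Σ (λ i → sumFin m (λ x → f i (Fin.suc x)))
      ≡⟨ cong (λ s → Σ (λ i → f i Fin.zero) + s) (swap-sumFin m (λ i x → f i (Fin.suc x))) ⟩
    Σ (λ i → f i Fin.zero) + sumFin m (λ x → Σ (λ i → f i (Fin.suc x)))
      ∎
    where open ≡-Reasoning

sumFin-linear : ∀ n → IsLinearFunctional (sumFin n)
sumFin-linear n = record
  { cong-pointwise = cong-pointwise n
  ; additive       = additive n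
  ; homogeneous    = homogeneous n
  }
  where
  open ≡-Reasoning
  cong-pointwise : ∀ n {f g : Fin n → ℚ} → (∀ i → f i ≡ g i) → sumFin n f ≡ sumFin n g
  cong-pointwise zero    f≗g = refl
  cong-pointwise (suc n) f≗g = cong₂ _+_ (f≗g Fin.zero) (cong-pointwise n (λ i → f≗g (Fin.suc i)))
  additive : ∀ n (f g : Fin n → ℚ) → sumFin n (λ i → f i + g i) ≡ sumFin n f + sumFin n g
  additive zero    f g = refl
  additive (suc n) f g = begin
    (f Fin.zero + g Fin.zero) + sumFin n (λ i → f (Fin.suc i) + g (Fin.suc i))
      ≡⟨ cong (λ s → f Fin.zero + g Fin.zero + s) (additive n _ _) ⟩
    (f Fin.zero + g Fin.zero) + (sumFin n (λ i → f (Fin.suc i)) + sumFin n (λ i → g (Fin.suc i)))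
      ≡⟨ interchange (f Fin.zero) (g Fin.zero) _ _ ⟩
    sumFin (suc n) f + sumFin (suc n) g ∎
  homogeneous : ∀ n c (f : Fin n → ℚ) → sumFin n (λ i → c * f i) ≡ c * sumFin n f
  homogeneous zero    c f = sym (ℚ.*-zeroʳ c)
  homogeneous (suc n) c f = begin
    c * f Fin.zero + sumFin n (λ i → c * f (Fin.suc i)) ≡⟨ cong (λ s → c * f Fin.zero + s) (homogeneous n c _) ⟩
    c * f Fin.zero + c * sumFin n (λ i → f (Fin.suc i)) ≡⟨ ℚ.*-distribˡ-+ c _ _ ⟨
    c * sumFin (suc n) f                                ∎

sumℕ-linear : ∀ n → IsLinearFunctional (sumℕ n)
sumℕ-linear n = record
  { cong-pointwise = cong-pointwise n
  ; additive       = additive n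
  ; homogeneous    = homogeneous n
  }
  where
  open ≡-Reasoning
  cong-pointwise : ∀ n {f g : ℕ → ℚ} → (∀ i → f i ≡ g i) → sumℕ n f ≡ sumℕ n g
  cong-pointwise zero    f≗g = refl
  cong-pointwise (suc n) f≗g = cong₂ _+_ (cong-pointwise n f≗g) (f≗g n)
  additive : ∀ n (f g : ℕ → ℚ) → sumℕ n (λ i → f i + g i) ≡ sumℕ n f + sumℕ n g
  additive zero    f g = refl
  additive (suc n) f g = begin
    sumℕ n (λ i → f i + g i) + (f n + g n)  ≡⟨ cong₂ _+_ (additive n f g) refl ⟩
    (sumℕ n f + sumℕ n g) + (f n + g n)     ≡⟨ interchange (sumℕ n f) (sumℕ n g) (f n) (g n) ⟩
    sumℕ (suc n) f + sumℕ (suc n) g         ∎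
  homogeneous : ∀ n c (f : ℕ → ℚ) → sumℕ n (λ i → c * f i) ≡ c * sumℕ n f
  homogeneous zero    c f = sym (ℚ.*-zeroʳ c)
  homogeneous (suc n) c f = begin
    sumℕ n (λ i → c * f i) + c * f n  ≡⟨ cong₂ _+_ (homogeneous n c f) refl ⟩
    c * sumℕ n f + c * f n            ≡⟨ ℚ.*-distribˡ-+ c _ _ ⟨
    c * sumℕ (suc n) f                ∎

Vector : ℕ → Set
Vector m = Fin m → ℚ

infix 7 _·_
_·_ : ∀ {m} → Vector m → Vector m → ℚ
u · v = sumFin _ (λ x → u x * v x)

·-comm : ∀ {m} (u v : Vector m) → u · v ≡ v · u
·-comm {m} u v = IsLinearFunctional.cong-pointwise (sumFin-linear m) (λ x → ℚ.*-comm (u x) (v x))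

module _ {I : Set} {Σ : (I → ℚ) → ℚ} (Σ-linear : IsLinearFunctional Σ) where
  open IsLinearFunctional Σ-linear

  Σ-·ʳ : ∀ {m} (u : Vector m) (v : I → Vector m) → Σ (λ i → u · v i) ≡ u · (λ x → Σ (λ i → v i x))
  Σ-·ʳ {m} u v = trans (swap-sumFin m (λ i x → u x * v i x))
    (IsLinearFunctional.cong-pointwise (sumFin-linear m) (λ x → homogeneous (u x) (λ i → v i x)))

  Σ-·ˡ : ∀ {m} (u : I → Vector m) (v : Vector m) → Σ (λ i → u i · v) ≡ (λ x → Σ (λ i → u i x)) · v
  Σ-·ˡ u v = begin
    Σ (λ i → u i · v)               ≡⟨ cong-pointwise (λ i → ·-comm (u i) v) ⟩
    Σ (λ i → v · u i)               ≡⟨ Σ-·ʳ v u ⟩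
    v · (λ x → Σ (λ i → u i x))     ≡⟨ ·-comm v _ ⟩
    (λ x → Σ (λ i → u i x)) · v     ∎
    where open ≡-Reasoning

sq-nonNeg : ∀ p → 0ℚ ≤ sq p
sq-nonNeg p with ℚ.≤-total 0ℚ p
... | inj₁ 0≤p = let instance _ = nonNegative 0≤p in ℚ.nonNegative⁻¹ (p * p) {{ℚ.nonNeg*nonNeg⇒nonNeg p p}}
-- Despite its name, nonPos*nonPos⇒nonPos concludes NonNegative.
... | inj₂ p≤0 = let instance _ = nonPositive p≤0 in ℚ.nonNegative⁻¹ (p * p) {{ℚ.nonPos*nonPos⇒nonPos p p}}

0≤q-p⇒p≤q : ∀ {p q} → 0ℚ ≤ q - p → p ≤ q
0≤q-p⇒p≤q {p} {q} 0≤q-p = begin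
  p            ≡⟨ ℚ.+-identityʳ p ⟨
  p + 0ℚ       ≤⟨ ℚ.+-monoʳ-≤ p 0≤q-p ⟩
  p + (q - p)  ≡⟨ solve 2 (λ p q → p :+ (q :- p) := q) refl p q ⟩
  q            ∎
  where open ℚ.≤-Reasoning

·-self-nonNeg : ∀ {m} (v : Vector m) → 0ℚ ≤ v · v
·-self-nonNeg {zero}  v = ℚ.≤-refl
·-self-nonNeg {suc m} v = begin
  0ℚ                                  ≤⟨ sq-nonNeg (v Fin.zero) ⟩
  sq (v Fin.zero)                     ≡⟨ ℚ.+-identityʳ _ ⟨
  sq (v Fin.zero) + 0ℚ                ≤⟨ ℚ.+-monoʳ-≤ (sq (v Fin.zero)) (·-self-nonNeg (v ∘ Fin.suc)) ⟩
  sq (v Fin.zero) + (v ∘ Fin.suc) · (v ∘ Fin.suc) ∎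
  where open ℚ.≤-Reasoning

·-expand : ∀ {m} a b (u v : Vector m) →
           (λ x → a * u x - b * v x) · (λ x → a * u x - b * v x)
           ≡ a * a * (u · u) - (a + a) * b * (u · v) + b * b * (v · v)
·-expand {zero} a b u v =
  solve 2 (λ a b → con 0ℚ := a :* a :* con 0ℚ :- (a :+ a) :* b :* con 0ℚ :+ b :* b :* con 0ℚ) refl a b
·-expand {suc m} a b u v =
  trans (cong (λ s → sq (a * u Fin.zero - b * v Fin.zero) + s) (·-expand a b (u ∘ Fin.suc) (v ∘ Fin.suc)))
        (solve 7 (λ a b u₀ v₀ uu uv vv →
           (a :* u₀ :- b :* v₀) :* (a :* u₀ :- b :* v₀) :+ (a :* a :* uu :- (a :+ a) :* b :* uv :+ b :* b :* vv)
           := a :* a :* (u₀ :* u₀ :+ uu) :- (a :+ a) :* b :* (u₀ :* v₀ :+ uv) :+ b :* b :* (v₀ :* v₀ :+ vv))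
           refl a b (u Fin.zero) (v Fin.zero)
           ((u ∘ Fin.suc) · (u ∘ Fin.suc)) ((u ∘ Fin.suc) · (v ∘ Fin.suc)) ((v ∘ Fin.suc) · (v ∘ Fin.suc)))

-- Expand 0 ≤ |a u - b v|² with a = v · v and b = u · v.
cauchy-schwarz : ∀ {m} (u v : Vector m) → 0ℚ < v · v → sq (u · v) ≤ (u · u) * (v · v)
cauchy-schwarz u v 0<a = 0≤q-p⇒p≤q (ℚ.*-cancelˡ-≤-pos a (begin
  a * 0ℚ                                 ≡⟨ ℚ.*-zeroʳ a ⟩
  0ℚ                                     ≤⟨ ·-self-nonNeg (λ x → a * u x - b * v x) ⟩
  (λ x → a * u x - b * v x) · (λ x → a * u x - b * v x)
                                         ≡⟨ ·-expand a b u v ⟩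
  a * a * (u · u) - (a + a) * b * b + b * b * a
                                         ≡⟨ solve 3 (λ a b uu → a :* a :* uu :- (a :+ a) :* b :* b :+ b :* b :* a
                                                               := a :* (uu :* a :- b :* b)) refl a b (u · u) ⟩
  a * ((u · u) * a - sq b)               ∎))
  where
  open ℚ.≤-Reasoning
  a = v · v
  b = u · v
  instance _ = positive 0<a

indicator : Event → Vector 5
indicator S x = if lookup S x then 1ℚ else 0ℚ

ℙ-indicator : ∀ S → ℙ S ≡ + 1 / 5 * sumFin 5 (indicator S)
ℙ-indicator S = trans (cong-pointwise (λ x → uniform-mass (lookup S x))) (homogeneous (+ 1 / 5) (indicator S))
  where
  open IsLinearFunctional (sumFin-linear 5)
  uniform-mass : ∀ b → (if b then + 1 / 5 else 0ℚ) ≡ + 1 / 5 * (if b then 1ℚ else 0ℚ)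
  uniform-mass true  = refl
  uniform-mass false = refl

indicator-∩ : ∀ S T x → indicator (S ∩ T) x ≡ indicator S x * indicator T x
indicator-∩ S T x rewrite lookup-zipWith _∧_ x S T = ∧-as-product (lookup S x) (lookup T x)
  where
  ∧-as-product : ∀ b c → (if b ∧ c then 1ℚ else 0ℚ) ≡ (if b then 1ℚ else 0ℚ) * (if c then 1ℚ else 0ℚ)
  ∧-as-product true  true  = refl
  ∧-as-product true  false = refl
  ∧-as-product false c     = sym (ℚ.*-zeroˡ (if c then 1ℚ else 0ℚ))

ℙ-∩ : ∀ S T → ℙ (S ∩ T) ≡ + 1 / 5 * (indicator S · indicator T)
ℙ-∩ S T = trans (ℙ-indicator (S ∩ T))
  (cong (+ 1 / 5 *_) (IsLinearFunctional.cong-pointwise (sumFin-linear 5) (indicator-∩ S T)))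

·-scale : ∀ {m} a b (u v : Vector m) → (λ x → a * u x) · (λ x → b * v x) ≡ a * b * (u · v)
·-scale {m} a b u v = trans
  (cong-pointwise (λ x → solve 4 (λ a b u v → (a :* u) :* (b :* v) := a :* b :* (u :* v)) refl a b (u x) (v x)))
  (homogeneous (a * b) (λ x → u x * v x))
  where open IsLinearFunctional (sumFin-linear m)

·-scaleˡ : ∀ {m} a (u v : Vector m) → (λ x → a * u x) · v ≡ a * (u · v)
·-scaleˡ {m} a u v = trans
  (cong-pointwise (λ x → ℚ.*-assoc a (u x) (v x)))
  (homogeneous a (λ x → u x * v x))
  where open IsLinearFunctional (sumFin-linear m)

module Moments {I : Set} {Σ : (I → ℚ) → ℚ} (Σ-linear : IsLinearFunctional Σ)
               (w : I → ℚ) (E : I → Event) where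
  open IsLinearFunctional Σ-linear
  open ≡-Reasoning

  weighted : I → Vector 5
  weighted i x = w i * indicator (E i) x

  mass : Vector 5
  mass x = Σ (λ i → weighted i x)

  first-moment : Σ (λ i → w i * ℙ (E i)) ≡ + 1 / 5 * sumFin 5 mass
  first-moment = begin
    Σ (λ i → w i * ℙ (E i))                            ≡⟨ cong-pointwise weighted-ℙ ⟩
    Σ (λ i → + 1 / 5 * sumFin 5 (weighted i))          ≡⟨ homogeneous (+ 1 / 5) _ ⟩
    + 1 / 5 * Σ (λ i → sumFin 5 (weighted i))          ≡⟨ cong (+ 1 / 5 *_) (swap-sumFin 5 weighted) ⟩
    + 1 / 5 * sumFin 5 mass                            ∎
    where
    weighted-ℙ : ∀ i → w i * ℙ (E i) ≡ + 1 / 5 * sumFin 5 (weighted i)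
    weighted-ℙ i = begin
      w i * ℙ (E i)                                    ≡⟨ cong (w i *_) (ℙ-indicator (E i)) ⟩
      w i * (+ 1 / 5 * sumFin 5 (indicator (E i)))     ≡⟨ ℚ.*-assoc (w i) _ _ ⟨
      w i * (+ 1 / 5) * sumFin 5 (indicator (E i))     ≡⟨ cong (_* sumFin 5 (indicator (E i))) (ℚ.*-comm (w i) (+ 1 / 5)) ⟩
      + 1 / 5 * w i * sumFin 5 (indicator (E i))       ≡⟨ ℚ.*-assoc (+ 1 / 5) (w i) _ ⟩
      + 1 / 5 * (w i * sumFin 5 (indicator (E i)))     ≡⟨ cong (+ 1 / 5 *_) (IsLinearFunctional.homogeneous (sumFin-linear 5) (w i) (indicator (E i))) ⟨
      + 1 / 5 * sumFin 5 (weighted i)                  ∎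

  second-moment : Σ (λ i → Σ (λ j → w i * w j * ℙ (E i ∩ E j))) ≡ + 1 / 5 * (mass · mass)
  second-moment = begin
    Σ (λ i → Σ (λ j → w i * w j * ℙ (E i ∩ E j)))
      ≡⟨ cong-pointwise (λ i → cong-pointwise (λ j → weighted-ℙ-∩ i j)) ⟩
    Σ (λ i → Σ (λ j → + 1 / 5 * (weighted i · weighted j)))
      ≡⟨ cong-pointwise (λ i → homogeneous (+ 1 / 5) _) ⟩
    Σ (λ i → + 1 / 5 * Σ (λ j → weighted i · weighted j))
      ≡⟨ homogeneous (+ 1 / 5) _ ⟩
    + 1 / 5 * Σ (λ i → Σ (λ j → weighted i · weighted j))
      ≡⟨ cong (+ 1 / 5 *_) (cong-pointwise (λ i → Σ-·ʳ Σ-linear (weighted i) weighted)) ⟩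
    + 1 / 5 * Σ (λ i → weighted i · mass)
      ≡⟨ cong (+ 1 / 5 *_) (Σ-·ˡ Σ-linear weighted mass) ⟩
    + 1 / 5 * (mass · mass)
      ∎
    where
    weighted-ℙ-∩ : ∀ i j → w i * w j * ℙ (E i ∩ E j) ≡ + 1 / 5 * (weighted i · weighted j)
    weighted-ℙ-∩ i j = begin
      w i * w j * ℙ (E i ∩ E j)
        ≡⟨ cong (w i * w j *_) (ℙ-∩ (E i) (E j)) ⟩
      w i * w j * (+ 1 / 5 * (indicator (E i) · indicator (E j)))
        ≡⟨ solve 3 (λ a c d → a :* (c :* d) := c :* (a :* d)) refl (w i * w j) (+ 1 / 5) (indicator (E i) · indicator (E j)) ⟩
      + 1 / 5 * (w i * w j * (indicator (E i) · indicator (E j)))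
        ≡⟨ cong (+ 1 / 5 *_) (·-scale (w i) (w j) (indicator (E i)) (indicator (E j))) ⟨
      + 1 / 5 * (weighted i · weighted j)
        ∎

  mass-orthogonal : ∀ (v : Vector 5) → (∀ i → indicator (E i) · v ≡ 0ℚ) → mass · v ≡ 0ℚ
  mass-orthogonal v E⊥v = begin
    mass · v                         ≡⟨ Σ-·ˡ Σ-linear weighted v ⟨
    Σ (λ i → weighted i · v)         ≡⟨ cong-pointwise weighted-orthogonal ⟩
    Σ (λ _ → 0ℚ)                     ≡⟨ sum-zero ⟩
    0ℚ                               ∎
    where
    weighted-orthogonal : ∀ i → weighted i · v ≡ 0ℚ
    weighted-orthogonal i = begin
      weighted i · v                 ≡⟨ ·-scaleˡ (w i) (indicator (E i)) v ⟩
      w i * (indicator (E i) · v)    ≡⟨ cong (w i *_) (E⊥v i) ⟩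
      w i * 0ℚ                       ≡⟨ ℚ.*-zeroʳ (w i) ⟩
      0ℚ                             ∎

normal : Vector 5
normal Fin.zero                                  = 1ℚ
normal (Fin.suc Fin.zero)                        = 1ℚ
normal (Fin.suc (Fin.suc Fin.zero))              = - (+ 2 / 1)
normal (Fin.suc (Fin.suc (Fin.suc Fin.zero)))    = - (+ 2 / 1)
normal (Fin.suc (Fin.suc (Fin.suc (Fin.suc _)))) = 1ℚ

Balanced : Event → Set
Balanced S = indicator S · normal ≡ 0ℚ

B-balanced : ∀ i → Balanced (B i)
B-balanced Fin.zero                                                  = refl
B-balanced (Fin.suc Fin.zero)                                        = refl
B-balanced (Fin.suc (Fin.suc Fin.zero))                              = refl
B-balanced (Fin.suc (Fin.suc (Fin.suc Fin.zero)))                    = refl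
B-balanced (Fin.suc (Fin.suc (Fin.suc (Fin.suc Fin.zero))))          = refl
B-balanced (Fin.suc (Fin.suc (Fin.suc (Fin.suc (Fin.suc Fin.zero))))) = refl

-- 11 times the orthogonal projection of (1,…,1) onto the hyperplane normal to `normal`;
-- its squared length 594 / 121 = 5 · 54 / 55 is where the constant comes from.
projected-unit : Vector 5
projected-unit Fin.zero                                  = + 12 / 1
projected-unit (Fin.suc Fin.zero)                        = + 12 / 1
projected-unit (Fin.suc (Fin.suc Fin.zero))              = + 9 / 1
projected-unit (Fin.suc (Fin.suc (Fin.suc Fin.zero)))    = + 9 / 1
projected-unit (Fin.suc (Fin.suc (Fin.suc (Fin.suc _)))) = + 12 / 1

·-projected-unit : ∀ y → y · projected-unit ≡ + 11 / 1 * sumFin 5 y + y · normal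
·-projected-unit y =
  solve 5 (λ y₀ y₁ y₂ y₃ y₄ →
      y₀ :* con (+ 12 / 1) :+ (y₁ :* con (+ 12 / 1) :+ (y₂ :* con (+ 9 / 1) :+ (y₃ :* con (+ 9 / 1) :+ (y₄ :* con (+ 12 / 1) :+ con 0ℚ))))
    := con (+ 11 / 1) :* (y₀ :+ (y₁ :+ (y₂ :+ (y₃ :+ (y₄ :+ con 0ℚ)))))
       :+ (y₀ :* con 1ℚ :+ (y₁ :* con 1ℚ :+ (y₂ :* con (- (+ 2 / 1)) :+ (y₃ :* con (- (+ 2 / 1)) :+ (y₄ :* con 1ℚ :+ con 0ℚ))))))
    refl (y Fin.zero) (y (Fin.suc Fin.zero)) (y (Fin.suc (Fin.suc Fin.zero)))
         (y (Fin.suc (Fin.suc (Fin.suc Fin.zero)))) (y (Fin.suc (Fin.suc (Fin.suc (Fin.suc Fin.zero)))))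

hyperplane-bound : ∀ y → y · normal ≡ 0ℚ → sq (+ 1 / 5 * sumFin 5 y) ≤ + 54 / 55 * (+ 1 / 5 * (y · y))
hyperplane-bound y y⊥normal = begin
  sq (+ 1 / 5 * s)                       ≡⟨ solve 1 (λ s → (con (+ 1 / 5) :* s) :* (con (+ 1 / 5) :* s)
                                                        := con (+ 1 / 3025) :* ((con (+ 11 / 1) :* s) :* (con (+ 11 / 1) :* s))) refl s ⟩
  + 1 / 3025 * sq (+ 11 / 1 * s)         ≡⟨ cong (λ p → + 1 / 3025 * sq p) y·v≡11s ⟨
  + 1 / 3025 * sq (y · projected-unit)   ≤⟨ ℚ.*-monoˡ-≤-nonNeg (+ 1 / 3025) (cauchy-schwarz y projected-unit 0<|v|²) ⟩
  + 1 / 3025 * ((y · y) * (+ 594 / 1))   ≡⟨ solve 1 (λ q → con (+ 1 / 3025) :* (q :* con (+ 594 / 1))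
                                                        := con (+ 54 / 55) :* (con (+ 1 / 5) :* q)) refl (y · y) ⟩
  + 54 / 55 * (+ 1 / 5 * (y · y))        ∎
  where
  open ℚ.≤-Reasoning
  s = sumFin 5 y
  0<|v|² : 0ℚ < projected-unit · projected-unit
  0<|v|² = toWitness {a? = 0ℚ ℚ.<? + 594 / 1} tt
  y·v≡11s : y · projected-unit ≡ + 11 / 1 * s
  y·v≡11s = trans (·-projected-unit y) (trans (cong (λ p → + 11 / 1 * s + p) y⊥normal) (ℚ.+-identityʳ _))

p÷q*q≡p : ∀ p q .{{_ : NonZero q}} → p ÷ q * q ≡ p
p÷q*q≡p p q = begin
  p ÷ q * q        ≡⟨ ℚ.*-assoc p (1/ q) q ⟩
  p * (1/ q * q)   ≡⟨ cong (p *_) (ℚ.*-inverseˡ q) ⟩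
  p * 1ℚ           ≡⟨ ℚ.*-identityʳ p ⟩
  p                ∎
  where open ≡-Reasoning

frac-≤ : ∀ {N D c} → 0ℚ ≤ c → 0ℚ ≤ D → N ≤ c * D → frac N D ≤ c
frac-≤ {N} {D} {c} 0≤c 0≤D N≤cD with D ℚ.≟ 0ℚ
... | yes _    = 0≤c
... | no  D≢0 = ℚ.*-cancelʳ-≤-pos D (begin
  N ÷ D * D           ≡⟨ p÷q*q≡p N D ⟩
  N                   ≤⟨ N≤cD ⟩
  c * D               ∎)
  where
  open ℚ.≤-Reasoning
  instance
    _ = ≢-nonZero D≢0
    _ = positive (ℚ.≰⇒> (λ D≤0 → D≢0 (ℚ.≤-antisym D≤0 0≤D)))

balanced-ratio-bound : ∀ {I : Set} {Σ : (I → ℚ) → ℚ} → IsLinearFunctional Σ →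
  ∀ (w : I → ℚ) (E : I → Event) → (∀ i → Balanced (E i)) →
  frac (sq (Σ (λ i → w i * ℙ (E i)))) (Σ (λ i → Σ (λ j → w i * w j * ℙ (E i ∩ E j)))) ≤ + 54 / 55
balanced-ratio-bound Σ-linear w E E-balanced =
  subst₂ (λ N D → frac (sq N) D ≤ + 54 / 55) (sym first-moment) (sym second-moment)
    (frac-≤ (toWitness {a? = 0ℚ ℚ.≤? + 54 / 55} tt)
            (ℚ.*-monoˡ-≤-nonNeg (+ 1 / 5) (·-self-nonNeg mass))
            (hyperplane-bound mass (mass-orthogonal normal E-balanced)))
  where open Moments Σ-linear w E

GK-bound : ∀ ω → GKratio ω ≤ + 54 / 55
GK-bound ω = balanced-ratio-bound (sumFin-linear 6) ω B B-balanced

ER-bound : ∀ (C : ℕ → Event) → (∀ k → Balanced (C k)) → ∀ n → ERratio C n ≤ + 54 / 55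
ER-bound C C-balanced n =
  subst₂ (λ N D → frac (sq N) D ≤ + 54 / 55)
    (cong-pointwise (λ k → ℚ.*-identityˡ (ℙ (C k))))
    (cong-pointwise (λ i → cong-pointwise (λ j → ℚ.*-identityˡ (ℙ (C i ∩ C j)))))
    (balanced-ratio-bound (sumℕ-linear n) (λ _ → 1ℚ) C C-balanced)
  where open IsLinearFunctional (sumℕ-linear n)

limsup-≤-of-bound : ∀ {r c} → (∀ n → r n ≤ c) → LimsupLE r c
limsup-≤-of-bound {r} {c} r≤c ε 0<ε = 0 , λ n _ → begin
  r n      ≤⟨ r≤c n ⟩
  c        ≡⟨ ℚ.+-identityʳ c ⟨
  c + 0ℚ   ≤⟨ ℚ.+-monoʳ-≤ c (ℚ.<⇒≤ 0<ε) ⟩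
  c + ε    ∎
  where open ℚ.≤-Reasoning

fromℕ : ℕ → ℚ
fromℕ n = mkℚ (+ n) 0 (Coprime.sym (Coprime.1-coprimeTo n))

fromℕ-suc : ∀ n → fromℕ (suc n) ≡ fromℕ n + 1ℚ
fromℕ-suc n = sym (trans (ℚ./-cong {p₂ = + suc n} numerator refl) (ℚ.↥p/↧p≡p (fromℕ (suc n))))
  where
  numerator : + n ℤ.* + 1 ℤ.+ + 1 ℤ.* + 1 ≡ + suc n
  numerator = trans (cong (ℤ._+ + 1) (ℤₚ.*-identityʳ (+ n))) (cong +_ (ℕₚ.+-comm n 1))

archimedean : ∀ p → p < fromℕ (suc ℤ.∣ ↥ p ∣)
archimedean (mkℚ (+ n) d _) = *<* (subst (ℤ._< + (suc n ℕ.* suc d)) (sym (ℤₚ.*-identityʳ (+ n)))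
  (ℤ.+<+ (ℕ.s≤s (ℕₚ.≤-trans (ℕₚ.m≤m*n n (suc d)) (ℕₚ.m≤n+m (n ℕ.* suc d) d)))))
archimedean (mkℚ -[1+ n ] d _) = *<* ℤ.-<+

sumℕ-lowerBound : ∀ {c a} → (∀ k → c ≤ a k) → ∀ n → fromℕ n * c ≤ sumℕ n a
sumℕ-lowerBound {c} c≤a zero    = ℚ.≤-reflexive (ℚ.*-zeroˡ c)
sumℕ-lowerBound {c} {a} c≤a (suc n) = begin
  fromℕ (suc n) * c        ≡⟨ cong (_* c) (fromℕ-suc n) ⟩
  (fromℕ n + 1ℚ) * c       ≡⟨ ℚ.*-distribʳ-+ c (fromℕ n) 1ℚ ⟩
  fromℕ n * c + 1ℚ * c     ≡⟨ cong (λ p → fromℕ n * c + p) (ℚ.*-identityˡ c) ⟩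
  fromℕ n * c + c          ≤⟨ ℚ.+-mono-≤ (sumℕ-lowerBound c≤a n) (c≤a n) ⟩
  sumℕ n a + a n           ∎
  where open ℚ.≤-Reasoning

boundedBelow⇒diverges : ∀ {c a} → 0ℚ < c → (∀ k → c ≤ a k) → SumDiverges a
boundedBelow⇒diverges {c} {a} 0<c c≤a M = n , (begin-strict
  M                ≡⟨ p÷q*q≡p M c ⟨
  M ÷ c * c        <⟨ ℚ.*-monoˡ-<-pos c (archimedean (M ÷ c)) ⟩
  fromℕ n * c      ≤⟨ sumℕ-lowerBound c≤a n ⟩
  sumℕ n a         ∎)
  where
  open ℚ.≤-Reasoning
  instance
    _ = positive 0<c
    _ = ℚ.pos⇒nonZero c
  n = suc ℤ.∣ ↥ (M ÷ c) ∣

ℙ-B : ∀ i → ℙ (B i) ≡ + 3 / 5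
ℙ-B Fin.zero                                                  = refl
ℙ-B (Fin.suc Fin.zero)                                        = refl
ℙ-B (Fin.suc (Fin.suc Fin.zero))                              = refl
ℙ-B (Fin.suc (Fin.suc (Fin.suc Fin.zero)))                    = refl
ℙ-B (Fin.suc (Fin.suc (Fin.suc (Fin.suc Fin.zero))))          = refl
ℙ-B (Fin.suc (Fin.suc (Fin.suc (Fin.suc (Fin.suc Fin.zero))))) = refl

ℙ-A : ∀ k → ℙ (A k) ≡ + 3 / 5
ℙ-A k = ℙ-B (fromℕ< (m%n<n k 6))

A-balanced : ∀ k → Balanced (A k)
A-balanced k = B-balanced (fromℕ< (m%n<n k 6))

B-cover : ∀ x → ∃ λ i → lookup (B i) x ≡ inside
B-cover Fin.zero                                         = Fin.zero , refl
B-cover (Fin.suc Fin.zero)                               = Fin.zero , refl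
B-cover (Fin.suc (Fin.suc Fin.zero))                     = Fin.suc Fin.zero , refl
B-cover (Fin.suc (Fin.suc (Fin.suc Fin.zero)))           = Fin.zero , refl
B-cover (Fin.suc (Fin.suc (Fin.suc (Fin.suc Fin.zero)))) = Fin.suc Fin.zero , refl

A-periodic : ∀ i n → A (toℕ i ℕ.+ n ℕ.* 6) ≡ B i
A-periodic i n = cong B (begin
  fromℕ< (m%n<n (toℕ i ℕ.+ n ℕ.* 6) 6) ≡⟨ fromℕ<-cong _ _ (trans ([m+kn]%n≡m%n (toℕ i) n 6) (m<n⇒m%n≡m (toℕ<n i))) _ (toℕ<n i) ⟩
  fromℕ< (toℕ<n i)                      ≡⟨ fromℕ<-toℕ i (toℕ<n i) ⟩
  i                                     ∎)
  where open ≡-Reasoning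

every-point-∈A∞ : ∀ x → x ∈A∞
every-point-∈A∞ x n with B-cover x
... | i , x∈Bi = toℕ i ℕ.+ n ℕ.* 6 , ℕₚ.≤-trans (ℕₚ.m≤m*n n 6) (ℕₚ.m≤n+m (n ℕ.* 6) (toℕ i)) ,
                 trans (cong (λ S → lookup S x) (A-periodic i n)) x∈Bi

mainTheorem2 : IsGK (+ 54 / 55)
               × (+ 54 / 55) < 1ℚ
               × KAT ≡ 1ℚ
               × SumDiverges (λ n → ℙ (A n))
               × ∃ (λ (S : Subset 5) → (∀ x → (x ∈ S) ⇔ (x ∈A∞)) × KAT ≤ ℙ S)
               × (∀ (τ : ℕ → ℕ) → StrictlyIncreasing τ → ERLE (λ n → A (τ n)) (+ 54 / 55))
mainTheorem2 =
  (GK-bound , (λ _ → 1ℚ) , refl) ,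
  toWitness {a? = + 54 / 55 ℚ.<? 1ℚ} tt ,
  refl ,
  boundedBelow⇒diverges (toWitness {a? = 0ℚ ℚ.<? + 3 / 5} tt) (λ k → ℚ.≤-reflexive (sym (ℙ-A k))) ,
  (⊤ , (λ x → mk⇔ (λ _ → every-point-∈A∞ x) (λ _ → ∈⊤)) , ℚ.≤-refl) ,
  -- the bound holds along every subsequence, increasing or not
  λ τ _ → limsup-≤-of-bound (ER-bound (λ n → A (τ n)) (λ k → A-balanced (τ k)))
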